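{- The rule $E_\neg$ is derivable in $ALFA_{Io}$: for every graph $A$, $\langle A\Rightarrow[\,]\rangle\vdash_{ALFA_{Io}}[A]$.
   Context: Graphs: the empty graph $\emptyset$ and propositional letters are graphs; if $G,H$ are graphs then so are the juxtaposition $GH$, the cut $[G]$ ($G$ inside a solid closed curve), the implication graph $\langle G\Rightarrow H\rangle$ (a solid closed curve containing $G$ and a dotted closed curve containing $H$), and the disjunction graph $\langle G\vee H\rangle$ (a solid closed curve containing two semi-dotted closed curves, one containing $G$ and one containing $H$; $\langle G\vee H\rangle=\langle H\vee G\rangle$). Juxtaposition is associative and commutative with unit $\emptyset$; $[\,]$ is the empty cut. Rules are schemata with $A,B,C$ arbitrary (possibly empty) graphs, applied to the whole graph on the sheet. The system $ALFA_{Io}$ has first-degree rules $MP_i: A\langle A\Rightarrow B\rangle\vdash B$; $I_\vee: A\vdash\langle A\vee B\rangle$; $R_2: AB\vdash A$; $I_{p3}:\langle A\vee B\rangle\vdash\langle[A]\Rightarrow B\rangle$; $I_{p2}: [AB]\vdash\langle A\Rightarrow[B]\rangle$; $E_p:\langle A\Rightarrow B\rangle\vdash[A[B]]$; and second-degree rules $R_{8i}$: if $AB\vdash C$ then $A\vdash\langle B\Rightarrow C\rangle$; $R_0$: if $A\vdash B$ and $A\vdash C$ then $A\vdash BC$; $E_\vee$: if $A\vdash C$ and $B\vdash C$ then $\langle A\vee B\rangle\vdash C$. $\vdash_{ALFA_{Io}}$ is the least transitive relation on graphs containing all instances of the first-degree rules and closed under the second-degree rules. -}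

module Defs where

open import Data.Nat using (ℕ)

data Graph : Set where
  ∅     : Graph
  letter : ℕ → Graph
  _·_   : Graph → Graph → Graph
  cut   : Graph → Graph                  -- [G]
  ⟨_⇒_⟩ : Graph → Graph → Graph
  ⟨_∨_⟩ : Graph → Graph → Graph

infixl 6 _·_

emptyCut : Graph
emptyCut = cut ∅

infix 4 _≈_ _⊢_

data _≈_ : Graph → Graph → Set where
  ≈-refl  : ∀ {G : Graph} → G ≈ G
  ≈-sym   : ∀ {G H : Graph} → G ≈ H → H ≈ G
  ≈-trans : ∀ {G H K : Graph} → G ≈ H → H ≈ K → G ≈ K
  ·-assoc : ∀ {G H K : Graph} → (G · H) · K ≈ G · (H · K)
  ·-comm  : ∀ {G H : Graph} → G · H ≈ H · G
  ·-unitˡ : ∀ {G : Graph} → ∅ · G ≈ G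
  ∨-comm  : ∀ {G H : Graph} → ⟨ G ∨ H ⟩ ≈ ⟨ H ∨ G ⟩
  ·-cong  : ∀ {G G' H H' : Graph} → G ≈ G' → H ≈ H' → G · H ≈ G' · H'
  cut-cong : ∀ {G G' : Graph} → G ≈ G' → cut G ≈ cut G'
  ⇒-cong  : ∀ {G G' H H' : Graph} → G ≈ G' → H ≈ H' → ⟨ G ⇒ H ⟩ ≈ ⟨ G' ⇒ H' ⟩
  ∨-cong  : ∀ {G G' H H' : Graph} → G ≈ G' → H ≈ H' → ⟨ G ∨ H ⟩ ≈ ⟨ G' ∨ H' ⟩

-- Derivability in ALFA_Io: the least transitive relation containing the
-- first-degree rules and closed under the second-degree rules (on graphs
-- taken up to the identification _≈_).
data _⊢_ : Graph → Graph → Set where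
  resp : ∀ {A A' B B'} → A ≈ A' → B ≈ B' → A ⊢ B → A' ⊢ B'
  trans⊢ : ∀ {A B C} → A ⊢ B → B ⊢ C → A ⊢ C
  -- first-degree rules
  MPᵢ : ∀ {A B} → (A · ⟨ A ⇒ B ⟩) ⊢ B
  I∨  : ∀ {A B} → A ⊢ ⟨ A ∨ B ⟩
  R₂  : ∀ {A B} → (A · B) ⊢ A
  Ip3 : ∀ {A B} → ⟨ A ∨ B ⟩ ⊢ ⟨ cut A ⇒ B ⟩
  Ip2 : ∀ {A B} → cut (A · B) ⊢ ⟨ A ⇒ cut B ⟩
  Ep  : ∀ {A B} → ⟨ A ⇒ B ⟩ ⊢ cut (A · cut B)
  -- second-degree rules
  R8ᵢ : ∀ {A B C} → (A · B) ⊢ C → A ⊢ ⟨ B ⇒ C ⟩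
  R₀  : ∀ {A B C} → A ⊢ B → A ⊢ C → A ⊢ (B · C)
  E∨  : ∀ {A B C} → A ⊢ C → B ⊢ C → ⟨ A ∨ B ⟩ ⊢ C

-- Any graph yields ⟨∅ ⇒ ∅⟩ by R8ᵢ, hence the double cut [[ ]] by Eₚ.
-- Contraposing ⟨A ⇒ [ ]⟩ through Eₚ and Iₚ₂ gives ⟨[[ ]] ⇒ [A]⟩,
-- and modus ponens on the two yields [A].
module Submission where

open import Defs

modusPonens : ∀ {G A B} → G ⊢ A → G ⊢ ⟨ A ⇒ B ⟩ → G ⊢ B
modusPonens ⊢A ⊢A⇒B = trans⊢ (R₀ ⊢A ⊢A⇒B) MPᵢ

⊢⟨∅⇒∅⟩ : ∀ {G} → G ⊢ ⟨ ∅ ⇒ ∅ ⟩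
⊢⟨∅⇒∅⟩ = R8ᵢ (resp ·-comm ≈-refl R₂)

⊢doubleEmptyCut : ∀ {G} → G ⊢ cut emptyCut
⊢doubleEmptyCut = trans⊢ ⊢⟨∅⇒∅⟩ (resp ≈-refl (cut-cong ·-unitˡ) Ep)

⇒-contrapose : ∀ {A B} → ⟨ A ⇒ B ⟩ ⊢ ⟨ cut B ⇒ cut A ⟩
⇒-contrapose = trans⊢ (resp ≈-refl (cut-cong ·-comm) Ep) Ip2

mainTheorem16 : (A : Graph) → ⟨ A ⇒ emptyCut ⟩ ⊢ cut A
mainTheorem16 A = modusPonens ⊢doubleEmptyCut ⇒-contrapose
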